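{- Let $G=(V,E)$ be an undirected graph on $n=|V|\ge 2$ vertices, and let $\vec{G}$ be an unknown acyclic orientation of $G$. Let $H$ be the complement graph of $G$ on $V$ (the graph of ``forbidden'' pairs), and suppose we are given a proper coloring $f:V\to\{1,\dots,k\}$ of $H$ (i.e. $f(x)\neq f(y)$ whenever $\{x,y\}$ is an edge of $H$). Then there is a deterministic adaptive algorithm that, with access to the probe oracle, determines the orientation of every edge of $E$ (i.e. determines $\vec{G}$) using $O(n\log n+nk)$ probes. In particular, $O(n\log n+n\chi(H))$ probes suffice to determine $\vec{G}$, where $\chi(H)$ is the chromatic number of $H$.
   Context: Probe model: for an edge $\{u,v\}\in E$, a probe of $(u,v)$ reveals whether the edge is oriented $u\to v$ or $v\to u$ in $\vec{G}$ (written $u\prec v$ or $v\prec u$). Only pairs that are edges of $G$ may be probed. No Hamiltonian path in $\vec{G}$ is assumed. The probe count is the number of oracle calls made in the worst case. -}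

module Defs where

open import Data.Nat using (ℕ; zero; suc; _+_)
open import Data.Fin using (Fin)
open import Data.Bool using (Bool; true; false; not)
open import Data.Product using (_×_)
open import Data.Unit using (⊤)
open import Relation.Nullary using (¬_)
open import Relation.Binary.PropositionalEquality using (_≡_; _≢_)
open import Relation.Binary.Construct.Closure.Transitive using (TransClosure)

record Graph (n : ℕ) : Set where
  field
    adj   : Fin n → Fin n → Bool
    sym   : ∀ u v → adj u v ≡ adj v u
    irrefl : ∀ u → adj u u ≡ false
open Graph public

Edge : ∀ {n} → Graph n → Fin n → Fin n → Set
Edge G u v = adj G u v ≡ true

EdgeH : ∀ {n} → Graph n → Fin n → Fin n → Set
EdgeH G x y = (x ≢ y) × (adj G x y ≡ false)

ProperColouringOfComplement : ∀ {n k} → Graph n → (Fin n → Fin k) → Set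
ProperColouringOfComplement G f = ∀ x y → EdgeH G x y → f x ≢ f y

-- An orientation: dir u v ≡ true means the edge {u,v} is oriented u → v.
-- Every edge gets exactly one direction; non-edges get none.
record IsOrientation {n} (G : Graph n) (dir : Fin n → Fin n → Bool) : Set where
  field
    onEdges    : ∀ u v → Edge G u v → dir v u ≡ not (dir u v)
    offEdges   : ∀ u v → adj G u v ≡ false → dir u v ≡ false

Arc : ∀ {n} → (Fin n → Fin n → Bool) → Fin n → Fin n → Set
Arc dir u v = dir u v ≡ true

Acyclic : ∀ {n} → (Fin n → Fin n → Bool) → Set
Acyclic {n} dir = ∀ (u : Fin n) → ¬ TransClosure (Arc dir) u u

IsAcyclicOrientation : ∀ {n} → Graph n → (Fin n → Fin n → Bool) → Set
IsAcyclicOrientation G dir = IsOrientation G dir × Acyclic dir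

-- Deterministic adaptive probing algorithms (decision trees):
-- either stop with an answer, or probe the pair (u,v) and continue
-- depending on the answer (true iff u ≺ v, i.e. u → v).
data Alg (n : ℕ) (A : Set) : Set where
  done  : A → Alg n A
  probe : Fin n → Fin n → (Bool → Alg n A) → Alg n A

run : ∀ {n A} → Alg n A → (Fin n → Fin n → Bool) → A
run (done a)      dir = a
run (probe u v k) dir = run (k (dir u v)) dir

probes : ∀ {n A} → Alg n A → (Fin n → Fin n → Bool) → ℕ
probes (done a)      dir = zero
probes (probe u v k) dir = suc (probes (k (dir u v)) dir)

ProbesOnlyEdges : ∀ {n A} → Graph n → Alg n A → (Fin n → Fin n → Bool) → Set
ProbesOnlyEdges G (done a)      dir = ⊤
ProbesOnlyEdges G (probe u v k) dir = Edge G u v × ProbesOnlyEdges G (k (dir u v)) dir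

Determines : ∀ {n} → Graph n → (Fin n → Fin n → Bool) → (Fin n → Fin n → Bool) → Set
Determines G out dir = ∀ u v → Edge G u v → out u v ≡ dir u v

-- Each colour class of a proper colouring of the complement of G is a clique of G, so the acyclic
-- orientation orders it totally and merge sort finds that order with ⌈log₂ n⌉ probes per vertex.
-- For a vertex v and another sorted class L, a neighbour of v in L preceding a neighbour that
-- points to v reaches v, hence points to v itself; so the edges between v and L are oriented by a
-- single cut of L.  Going through the class of v in sorted order, the part of L known to reach the
-- current vertex only grows, so one sweep finds all these cuts with at most |class| + |L| probes.
-- In total n ⌈log₂ n⌉ + 2 k n probes suffice.
module Submission where

open import Defs hiding (sym)

open import Data.Bool using (Bool; true; false; not; if_then_else_)
open import Data.Empty using (⊥-elim)
open import Data.Fin using (Fin; zero; suc)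
open import Data.Fin.Properties using () renaming (_≟_ to _≟ᶠ_)
import Data.List as List
open import Data.List using (List; []; _∷_; _++_; _∷ʳ_; length; take; drop; filter; allFin)
open import Data.List.Membership.Propositional using (_∈_)
open import Data.List.Membership.Propositional.Properties using (∈-++⁻; ∈-filter⁺; ∈-allFin)
open import Data.List.Properties
  using (∷ʳ-++; ++-identityʳ; length-++; length-take; length-drop; length-filter; length-tabulate; take++drop≡id)
open import Data.List.Relation.Binary.Permutation.Propositional
  using (_↭_; ↭-refl; ↭-sym; ↭-trans; ↭-reflexive; prep; module PermutationReasoning)
open import Data.List.Relation.Binary.Permutation.Propositional.Properties
  using (shift; ++⁺; ↭-length; All-resp-↭; ∈-resp-↭)
open import Data.List.Relation.Unary.All as All using (All; []; _∷_)
import Data.List.Relation.Unary.All.Properties as All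
open import Data.List.Relation.Unary.AllPairs using (AllPairs; []; _∷_)
open import Data.List.Relation.Unary.Any using (here; there)
open import Data.Nat using (ℕ; zero; suc; _+_; _*_; _∸_; _^_; _≤_; _<_; z≤n; s≤s; ⌊_/2⌋; ⌈_/2⌉)
open import Data.Nat.Induction using (<-wellFounded)
open import Data.Nat.Logarithm using (⌈log₂_⌉)
open import Data.Nat.Logarithm.Core using (⌈log2⌉)
open import Data.Nat.Properties
open import Algebra.Properties.CommutativeSemigroup +-commutativeSemigroup using (x∙yz≈y∙xz)
open import Algebra.Properties.Semiring.Sum +-*-semiring
  using (sum; sum-syntax; ∑-distrib-+; *-distribˡ-sum; sum-cong-≗)
open import Data.Nat.Tactic.RingSolver using (solve-∀)
open import Data.Product using (Σ; _×_; _,_; proj₁; proj₂)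
open import Data.Sum using (inj₁; inj₂)
open import Data.Unit using (tt)
import Data.Vec.Functional as Vector
open import Data.Vec.Functional.Properties using (updateAt-updates; updateAt-minimal)
open import Function using (_∘_; id)
open import Induction.WellFounded using (Acc; acc)
open import Relation.Binary using (Rel; Transitive)
open import Relation.Binary.Construct.Closure.ReflexiveTransitive using (Star; ε; _◅_; _◅◅_)
open import Relation.Binary.Construct.Closure.Transitive as Plus using (TransClosure)
open import Relation.Binary.PropositionalEquality hiding ([_])
open import Relation.Nullary using (Dec; yes; no; does)
open import Relation.Unary using (Pred; Decidable)

Oracle : ℕ → Set
Oracle n = Fin n → Fin n → Bool

module _ {n : ℕ} where

  infixl 1 _>>=_
  infixr 4 _<$>_

  _>>=_ : ∀ {A B} → Alg n A → (A → Alg n B) → Alg n B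
  done a      >>= k = k a
  probe u v c >>= k = probe u v (λ b → c b >>= k)

  _<$>_ : ∀ {A B} → (A → B) → Alg n A → Alg n B
  g <$> done a      = done (g a)
  g <$> probe u v c = probe u v (λ b → g <$> c b)

  module _ {A B : Set} (d : Oracle n) where

    run->>= : ∀ (P : Alg n A) (k : A → Alg n B) → run (P >>= k) d ≡ run (k (run P d)) d
    run->>= (done a)      k = refl
    run->>= (probe u v c) k = run->>= (c (d u v)) k

    probes->>= : ∀ (P : Alg n A) (k : A → Alg n B) →
                 probes (P >>= k) d ≡ probes P d + probes (k (run P d)) d
    probes->>= (done a)      k = refl
    probes->>= (probe u v c) k = cong suc (probes->>= (c (d u v)) k)

    run-<$> : ∀ (g : A → B) (P : Alg n A) → run (g <$> P) d ≡ g (run P d)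
    run-<$> g (done a)      = refl
    run-<$> g (probe u v c) = run-<$> g (c (d u v))

    probes-<$> : ∀ (g : A → B) (P : Alg n A) → probes (g <$> P) d ≡ probes P d
    probes-<$> g (done a)      = refl
    probes-<$> g (probe u v c) = cong suc (probes-<$> g (c (d u v)))

  -- Non-edges are never probed: their answer is taken to be false, as it is for every orientation.
  edgesOnly : ∀ {A} → Graph n → Alg n A → Alg n A
  edgesOnly G (done a)      = done a
  edgesOnly G (probe u v c) =
    if adj G u v then probe u v (λ b → edgesOnly G (c b)) else edgesOnly G (c false)

  edgesOnly-probesOnlyEdges : ∀ {A} (G : Graph n) (P : Alg n A) (d : Oracle n) →
                              ProbesOnlyEdges G (edgesOnly G P) d
  edgesOnly-probesOnlyEdges G (done a)      d = tt
  edgesOnly-probesOnlyEdges G (probe u v c) d with adj G u v in uv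
  ... | true  = uv , edgesOnly-probesOnlyEdges G (c (d u v)) d
  ... | false = edgesOnly-probesOnlyEdges G (c false) d

  module _ {A : Set} (G : Graph n) (d : Oracle n)
           (silent : ∀ u v → adj G u v ≡ false → d u v ≡ false) where

    run-edgesOnly : ∀ (P : Alg n A) → run (edgesOnly G P) d ≡ run P d
    run-edgesOnly (done a)      = refl
    run-edgesOnly (probe u v c) with adj G u v in uv
    ... | true  = run-edgesOnly (c (d u v))
    ... | false rewrite silent u v uv = run-edgesOnly (c false)

    probes-edgesOnly : ∀ (P : Alg n A) → probes (edgesOnly G P) d ≤ probes P d
    probes-edgesOnly (done a)      = z≤n
    probes-edgesOnly (probe u v c) with adj G u v in uv
    ... | true  = s≤s (probes-edgesOnly (c (d u v)))
    ... | false rewrite silent u v uv = m≤n⇒m≤1+n (probes-edgesOnly (c false))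

  forEach : ∀ {A k} → (Fin k → Alg n A) → Alg n (Fin k → A)
  forEach {k = zero}  g = done λ ()
  forEach {k = suc k} g = g zero >>= λ a → (a Vector.∷_) <$> forEach (g ∘ suc)

  module _ {A : Set} (d : Oracle n) where

    run-forEach : ∀ {k} (g : Fin k → Alg n A) i → run (forEach g) d i ≡ run (g i) d
    run-forEach {suc k} g i
      rewrite run->>= d (g zero) (λ a → (a Vector.∷_) <$> forEach (g ∘ suc))
            | run-<$> d (run (g zero) d Vector.∷_) (forEach (g ∘ suc))
      with i
    ... | zero  = refl
    ... | suc j = run-forEach (g ∘ suc) j

    probes-forEach : ∀ {k} (g : Fin k → Alg n A) → probes (forEach g) d ≡ ∑[ i < k ] probes (g i) d
    probes-forEach {zero}  g = refl
    probes-forEach {suc k} g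
      rewrite probes->>= d (g zero) (λ a → (a Vector.∷_) <$> forEach (g ∘ suc))
            | probes-<$> d (run (g zero) d Vector.∷_) (forEach (g ∘ suc))
      = cong (probes (g zero) d +_) (probes-forEach (g ∘ suc))

∑-mono-≤ : ∀ {k} {g h : Fin k → ℕ} → (∀ i → g i ≤ h i) → sum g ≤ sum h
∑-mono-≤ {zero}  g≤h = z≤n
∑-mono-≤ {suc k} g≤h = +-mono-≤ (g≤h zero) (∑-mono-≤ (g≤h ∘ suc))

∑-const : ∀ k c → ∑[ _ < k ] c ≡ k * c
∑-const zero    c = refl
∑-const (suc k) c = cong (c +_) (∑-const k c)

∑∑-pairs : ∀ {k} (a : Fin k → ℕ) → ∑[ i < k ] ∑[ j < k ] (a i + a j) ≡ k * sum a + k * sum a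
∑∑-pairs {k} a = begin
  ∑[ i < k ] ∑[ j < k ] (a i + a j)               ≡⟨ sum-cong-≗ (λ i → ∑-distrib-+ (λ _ → a i) a) ⟩
  ∑[ i < k ] (∑[ _ < k ] a i + sum a)             ≡⟨ ∑-distrib-+ (λ i → ∑[ _ < k ] a i) (λ _ → sum a) ⟩
  ∑[ i < k ] ∑[ _ < k ] a i + ∑[ _ < k ] sum a    ≡⟨ cong₂ _+_ (sum-cong-≗ (λ i → ∑-const k (a i))) (∑-const k (sum a)) ⟩
  ∑[ i < k ] (k * a i) + k * sum a                ≡⟨ cong (_+ k * sum a) (*-distribˡ-sum k a) ⟨
  k * sum a + k * sum a                           ∎
  where open ≡-Reasoning

∑-indicator : ∀ {k} (c : Fin k) → ∑[ i < k ] (if does (c ≟ᶠ i) then 1 else 0) ≡ 1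
∑-indicator {suc k} zero    = cong suc (trans (∑-const k 0) (*-zeroʳ k))
∑-indicator {suc k} (suc c) = ∑-indicator c

length-filter-∷ : ∀ {A : Set} {ℓ} {P : Pred A ℓ} (P? : Decidable P) x xs →
                  length (filter P? (x ∷ xs)) ≡ (if does (P? x) then 1 else 0) + length (filter P? xs)
length-filter-∷ P? x xs with does (P? x)
... | true  = refl
... | false = refl

sorted-split : ∀ {A : Set} {ℓ} {R : Rel A ℓ} xs {y ys} → AllPairs R (xs ++ y ∷ ys) →
               All (λ x → R x y) xs × All (R y) ys
sorted-split []       (y≤ys ∷ _)      = [] , y≤ys
sorted-split (x ∷ xs) (x≤xs++ys ∷ xs↑) =
  All.head (All.++⁻ʳ xs x≤xs++ys) ∷ proj₁ (sorted-split xs xs↑) , proj₂ (sorted-split xs xs↑)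

∑-length-filter-byColour : ∀ {A : Set} {k} (f : A → Fin k) xs →
                           ∑[ i < k ] length (filter (λ y → f y ≟ᶠ i) xs) ≡ length xs
∑-length-filter-byColour {k = k} f []       = trans (∑-const k 0) (*-zeroʳ k)
∑-length-filter-byColour {k = k} f (x ∷ xs) = begin
  ∑[ i < k ] length (filter (λ y → f y ≟ᶠ i) (x ∷ xs))
    ≡⟨ sum-cong-≗ (λ i → length-filter-∷ (λ y → f y ≟ᶠ i) x xs) ⟩
  ∑[ i < k ] ((if does (f x ≟ᶠ i) then 1 else 0) + length (filter (λ y → f y ≟ᶠ i) xs))
    ≡⟨ ∑-distrib-+ (λ i → if does (f x ≟ᶠ i) then 1 else 0) _ ⟩
  ∑[ i < k ] (if does (f x ≟ᶠ i) then 1 else 0) + ∑[ i < k ] length (filter (λ y → f y ≟ᶠ i) xs)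
    ≡⟨ cong₂ _+_ (∑-indicator (f x)) (∑-length-filter-byColour f xs) ⟩
  suc (length xs) ∎
  where open ≡-Reasoning

module _ {n : ℕ} where

  merge : List (Fin n) → List (Fin n) → Alg n (List (Fin n))
  merge []       ys       = done ys
  merge (x ∷ xs) []       = done (x ∷ xs)
  merge (x ∷ xs) (y ∷ ys) = probe x y λ x≺y →
    if x≺y then (x ∷_) <$> merge xs (y ∷ ys) else (y ∷_) <$> merge (x ∷ xs) ys

  mergeSort : ℕ → List (Fin n) → Alg n (List (Fin n))
  mergeSort zero    xs = done xs
  mergeSort (suc k) xs =
    mergeSort k (take (2 ^ k) xs) >>= λ ys → mergeSort k (drop (2 ^ k) xs) >>= λ zs → merge ys zs

  module _ (d : Oracle n) where

    merge-↭ : ∀ xs ys → run (merge xs ys) d ↭ xs ++ ys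
    merge-↭ []       ys       = ↭-refl
    merge-↭ (x ∷ xs) []       = ↭-sym (↭-reflexive (++-identityʳ (x ∷ xs)))
    merge-↭ (x ∷ xs) (y ∷ ys) = step (d x y) (merge-↭ xs (y ∷ ys)) (merge-↭ (x ∷ xs) ys)
      where
        step : ∀ b → run (merge xs (y ∷ ys)) d ↭ xs ++ y ∷ ys → run (merge (x ∷ xs) ys) d ↭ x ∷ xs ++ ys →
               run (if b then (x ∷_) <$> merge xs (y ∷ ys) else (y ∷_) <$> merge (x ∷ xs) ys) d
               ↭ x ∷ xs ++ y ∷ ys
        step true  left _ rewrite run-<$> d (List._∷_ x) (merge xs (y ∷ ys)) = prep x left
        step false _ right rewrite run-<$> d (List._∷_ y) (merge (x ∷ xs) ys) =
          ↭-trans (prep y right) (↭-sym (shift y (x ∷ xs) ys))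

    probes-merge : ∀ xs ys → probes (merge xs ys) d ≤ length xs + length ys
    probes-merge []       ys       = z≤n
    probes-merge (x ∷ xs) []       = z≤n
    probes-merge (x ∷ xs) (y ∷ ys) =
      s≤s (step (d x y) (probes-merge xs (y ∷ ys)) (probes-merge (x ∷ xs) ys))
      where
        open ≤-Reasoning
        step : ∀ b → probes (merge xs (y ∷ ys)) d ≤ length xs + suc (length ys) →
               probes (merge (x ∷ xs) ys) d ≤ suc (length xs + length ys) →
               probes (if b then (x ∷_) <$> merge xs (y ∷ ys) else (y ∷_) <$> merge (x ∷ xs) ys) d
               ≤ length xs + suc (length ys)
        step true  left _ = begin
          probes ((x ∷_) <$> merge xs (y ∷ ys)) d ≡⟨ probes-<$> d (List._∷_ x) (merge xs (y ∷ ys)) ⟩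
          probes (merge xs (y ∷ ys)) d           ≤⟨ left ⟩
          length xs + suc (length ys)            ∎
        step false _ right = begin
          probes ((y ∷_) <$> merge (x ∷ xs) ys) d ≡⟨ probes-<$> d (List._∷_ y) (merge (x ∷ xs) ys) ⟩
          probes (merge (x ∷ xs) ys) d           ≤⟨ right ⟩
          suc (length xs) + length ys            ≡⟨ +-suc (length xs) (length ys) ⟨
          length xs + suc (length ys)            ∎

    module _ (k : ℕ) (xs : List (Fin n)) where
      private
        ys = run (mergeSort k (take (2 ^ k) xs)) d
        zs = run (mergeSort k (drop (2 ^ k) xs)) d
        sortRightAndMerge = λ ys → mergeSort k (drop (2 ^ k) xs) >>= merge ys

      run-mergeSort-suc : run (mergeSort (suc k) xs) d ≡ run (merge ys zs) d
      run-mergeSort-suc = trans (run->>= d (mergeSort k (take (2 ^ k) xs)) sortRightAndMerge)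
                                (run->>= d (mergeSort k (drop (2 ^ k) xs)) (merge ys))

      probes-mergeSort-suc : probes (mergeSort (suc k) xs) d
        ≡ probes (mergeSort k (take (2 ^ k) xs)) d
          + (probes (mergeSort k (drop (2 ^ k) xs)) d + probes (merge ys zs) d)
      probes-mergeSort-suc = trans (probes->>= d (mergeSort k (take (2 ^ k) xs)) sortRightAndMerge)
        (cong (probes (mergeSort k (take (2 ^ k) xs)) d +_)
              (probes->>= d (mergeSort k (drop (2 ^ k) xs)) (merge ys)))

    mergeSort-↭ : ∀ k xs → run (mergeSort k xs) d ↭ xs
    mergeSort-↭ zero    xs = ↭-refl
    mergeSort-↭ (suc k) xs rewrite run-mergeSort-suc k xs = begin
      run (merge (run (mergeSort k ys) d) (run (mergeSort k zs) d)) d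
        ↭⟨ merge-↭ (run (mergeSort k ys) d) (run (mergeSort k zs) d) ⟩
      run (mergeSort k ys) d ++ run (mergeSort k zs) d
        ↭⟨ ++⁺ (mergeSort-↭ k ys) (mergeSort-↭ k zs) ⟩
      ys ++ zs
        ≡⟨ take++drop≡id (2 ^ k) xs ⟩
      xs ∎
      where
        open PermutationReasoning
        ys = take (2 ^ k) xs
        zs = drop (2 ^ k) xs

    probes-mergeSort : ∀ k xs → probes (mergeSort k xs) d ≤ k * length xs
    probes-mergeSort zero    xs = z≤n
    probes-mergeSort (suc k) xs rewrite probes-mergeSort-suc k xs = begin
      probes (mergeSort k ys) d + (probes (mergeSort k zs) d + probes (merge ys′ zs′) d)
        ≤⟨ +-mono-≤ (probes-mergeSort k ys) (+-mono-≤ (probes-mergeSort k zs) (probes-merge ys′ zs′)) ⟩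
      k * length ys + (k * length zs + (length ys′ + length zs′))
        ≡⟨ cong (λ m → k * length ys + (k * length zs + m))
                (cong₂ _+_ (↭-length (mergeSort-↭ k ys)) (↭-length (mergeSort-↭ k zs))) ⟩
      k * length ys + (k * length zs + (length ys + length zs))
        ≡⟨ regroup k (length ys) (length zs) ⟩
      suc k * (length ys + length zs)
        ≡⟨ cong (suc k *_) (trans (sym (length-++ ys)) (cong length (take++drop≡id (2 ^ k) xs))) ⟩
      suc k * length xs ∎
      where
        open ≤-Reasoning
        ys = take (2 ^ k) xs
        zs = drop (2 ^ k) xs
        ys′ = run (mergeSort k ys) d
        zs′ = run (mergeSort k zs) d
        regroup : ∀ k a b → k * a + (k * b + (a + b)) ≡ suc k * (a + b)
        regroup = solve-∀

  module _ (d : Oracle n) {ℓ ℓ′} {_≼_ : Rel (Fin n) ℓ} (≼-trans : Transitive _≼_) {Q : Pred (Fin n) ℓ′}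
           (true⇒≼ : ∀ {x y} → d x y ≡ true → x ≼ y)
           (false⇒≽ : ∀ {x y} → Q x → Q y → d x y ≡ false → y ≼ x) where

    merge-sorted : ∀ {xs ys} → All Q xs → All Q ys → AllPairs _≼_ xs → AllPairs _≼_ ys →
                   AllPairs _≼_ (run (merge xs ys) d)
    merge-sorted {[]}     {ys}     _ _ _ ys↑ = ys↑
    merge-sorted {x ∷ xs} {[]}     _ _ xs↑ _ = xs↑
    merge-sorted {x ∷ xs} {y ∷ ys} Qxs@(Qx ∷ Qxs′) Qys@(Qy ∷ Qys′) xs↑@(x≼xs ∷ xs′↑) ys↑@(y≼ys ∷ ys′↑) =
      step (d x y) refl (merge-sorted Qxs′ Qys xs′↑ ys↑) (merge-sorted Qxs Qys′ xs↑ ys′↑)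
      where
        step : ∀ b → d x y ≡ b →
               AllPairs _≼_ (run (merge xs (y ∷ ys)) d) → AllPairs _≼_ (run (merge (x ∷ xs) ys) d) →
               AllPairs _≼_ (run (if b then (x ∷_) <$> merge xs (y ∷ ys) else (y ∷_) <$> merge (x ∷ xs) ys) d)
        step true x≺y left _ rewrite run-<$> d (List._∷_ x) (merge xs (y ∷ ys)) =
          All-resp-↭ (↭-sym (merge-↭ d xs (y ∷ ys))) (All.++⁺ x≼xs (x≼y ∷ All.map (≼-trans x≼y) y≼ys)) ∷ left
          where x≼y = true⇒≼ x≺y
        step false y≺x _ right rewrite run-<$> d (List._∷_ y) (merge (x ∷ xs) ys) =
          All-resp-↭ (↭-sym (merge-↭ d (x ∷ xs) ys)) (y≼x ∷ All.++⁺ (All.map (≼-trans y≼x) x≼xs) y≼ys) ∷ right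
          where y≼x = false⇒≽ Qx Qy y≺x

    mergeSort-sorted : ∀ k xs → length xs ≤ 2 ^ k → All Q xs → AllPairs _≼_ (run (mergeSort k xs) d)
    mergeSort-sorted zero    []          _         _  = []
    mergeSort-sorted zero    (x ∷ [])    _         _  = [] ∷ []
    mergeSort-sorted zero    (_ ∷ _ ∷ _) (s≤s ())  _
    mergeSort-sorted (suc k) xs          |xs|≤2^k+1 Qxs rewrite run-mergeSort-suc d k xs =
      merge-sorted (All-resp-↭ (↭-sym (mergeSort-↭ d k ys)) Qys) (All-resp-↭ (↭-sym (mergeSort-↭ d k zs)) Qzs)
                   (mergeSort-sorted k ys |ys|≤2^k Qys) (mergeSort-sorted k zs |zs|≤2^k Qzs)
      where
        ys = take (2 ^ k) xs
        zs = drop (2 ^ k) xs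
        Qys++zs = subst (All Q) (sym (take++drop≡id (2 ^ k) xs)) Qxs
        Qys = All.++⁻ˡ ys Qys++zs
        Qzs = All.++⁻ʳ ys Qys++zs
        |ys|≤2^k : length ys ≤ 2 ^ k
        |ys|≤2^k = ≤-trans (≤-reflexive (length-take (2 ^ k) xs)) (m⊓n≤m (2 ^ k) (length xs))
        |zs|≤2^k : length zs ≤ 2 ^ k
        |zs|≤2^k = begin
          length zs                ≡⟨ length-drop (2 ^ k) xs ⟩
          length xs ∸ 2 ^ k        ≤⟨ ∸-monoˡ-≤ (2 ^ k) |xs|≤2^k+1 ⟩
          2 ^ k + (2 ^ k + 0) ∸ 2 ^ k ≡⟨ m+n∸m≡n (2 ^ k) (2 ^ k + 0) ⟩
          2 ^ k + 0                ≡⟨ +-identityʳ (2 ^ k) ⟩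
          2 ^ k                    ∎
          where open ≤-Reasoning

module _ {n : ℕ} (G : Graph n) where

  -- Scans cs for the first neighbour c with v → c, which starts the suffix of the cut of v.
  -- The second result is what follows the last neighbour found pointing to v;
  -- a later vertex of the same chain resumes scanning there.
  findCut : Fin n → List (Fin n) → List (Fin n) → Alg n (List (Fin n) × List (Fin n))
  findCut v rest []       = done ([] , rest)
  findCut v rest (c ∷ cs) =
    if adj G c v
    then probe c v (λ c≺v → if c≺v then findCut v cs cs else done (c ∷ cs , rest))
    else findCut v rest cs

  findCuts : List (Fin n) → List (Fin n) → Alg n (Fin n → List (Fin n))
  findCuts []       rest = done (λ _ → [])
  findCuts (v ∷ vs) rest = findCut v rest rest >>= λ r →
    (λ cuts → Vector.updateAt cuts v (λ _ → proj₁ r)) <$> findCuts vs (proj₂ r)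

  module _ (d : Oracle n) where

    probes-findCut : ∀ v rest cs → length cs ≤ length rest →
                     probes (findCut v rest cs) d + length (proj₂ (run (findCut v rest cs) d)) ≤ suc (length rest)
    probes-findCut v rest []       _        = n≤1+n (length rest)
    probes-findCut v rest (c ∷ cs) |c∷cs|≤ with adj G c v
    ... | false = probes-findCut v rest cs (<⇒≤ |c∷cs|≤)
    ... | true with d c v
    ...   | true  = s≤s (≤-trans (probes-findCut v cs cs ≤-refl) |c∷cs|≤)
    ...   | false = ≤-refl

    probes-findCuts : ∀ vs rest → probes (findCuts vs rest) d ≤ length vs + length rest
    probes-findCuts []       rest = z≤n
    probes-findCuts (v ∷ vs) rest = begin
      probes (findCuts (v ∷ vs) rest) d
        ≡⟨ trans (probes->>= d (findCut v rest rest) _) (cong (p +_) (probes-<$> d _ (findCuts vs rest′))) ⟩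
      p + probes (findCuts vs rest′) d    ≤⟨ +-monoʳ-≤ p (probes-findCuts vs rest′) ⟩
      p + (length vs + length rest′)     ≡⟨ x∙yz≈y∙xz p (length vs) (length rest′) ⟩
      length vs + (p + length rest′)     ≤⟨ +-monoʳ-≤ (length vs) (probes-findCut v rest rest ≤-refl) ⟩
      length vs + suc (length rest)      ≡⟨ +-suc (length vs) (length rest) ⟩
      suc (length vs + length rest)      ∎
      where
        open ≤-Reasoning
        p = probes (findCut v rest rest) d
        rest′ = proj₂ (run (findCut v rest rest) d)

    run-findCuts-∷ : ∀ v vs rest → let (suffix , rest′) = run (findCut v rest rest) d in
                     run (findCuts (v ∷ vs) rest) d ≡ Vector.updateAt (run (findCuts vs rest′) d) v (λ _ → suffix)
    run-findCuts-∷ v vs rest = trans (run->>= d (findCut v rest rest) _) (run-<$> d _ (findCuts vs _))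

module AcyclicOrientation {n : ℕ} {G : Graph n} {dir : Oracle n}
                          (orientation : IsOrientation G dir) (acyclic : Acyclic dir) where

  _⇝_ : Fin n → Fin n → Set
  _⇝_ = Star (Arc dir)

  reversed-arc : ∀ {u v} → Edge G u v → dir u v ≡ false → Arc dir v u
  reversed-arc {u} {v} uv u⊀v = trans (IsOrientation.onEdges orientation u v uv) (cong not u⊀v)

  path⇒no-back-arc : ∀ {u v} → u ⇝ v → dir v u ≡ false
  path⇒no-back-arc {u} {v} u⇝v with dir v u in v≺u
  ... | false = refl
  ... | true  = ⊥-elim (acyclic v (cycle v≺u u⇝v))
    where
      cycle : ∀ {x y z} → Arc dir x y → y ⇝ z → TransClosure (Arc dir) x z
      cycle x≺y ε             = Plus.[ x≺y ]
      cycle x≺y (y≺y′ ◅ y′⇝z) = x≺y Plus.∷ cycle y≺y′ y′⇝z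

  path⇒arc : ∀ {u v} → Edge G u v → u ⇝ v → dir u v ≡ true
  path⇒arc {u} {v} uv u⇝v with dir u v in u≺v
  ... | true = refl
  ... | false with () ← trans (sym (reversed-arc uv u≺v)) (path⇒no-back-arc u⇝v)

  record Cut (L : List (Fin n)) (v : Fin n) (suffix : List (Fin n)) : Set where
    constructor cut
    field
      prefix  : List (Fin n)
      split   : L ≡ prefix ++ suffix
      inward  : ∀ {c} → c ∈ prefix → Edge G c v → dir c v ≡ true
      outward : ∀ {c} → c ∈ suffix → Edge G c v → dir c v ≡ false

  record Reaching (L : List (Fin n)) (v : Fin n) (rest : List (Fin n)) : Set where
    constructor reaching
    field
      prefix : List (Fin n)
      split  : L ≡ prefix ++ rest
      reach  : All (_⇝ v) prefix

  module _ {L : List (Fin n)} (L↑ : AllPairs _⇝_ L) where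

    findCut-invariant : ∀ {v rest} pre cs → Reaching L v rest → L ≡ pre ++ cs →
                      (∀ {c} → c ∈ pre → Edge G c v → dir c v ≡ true) →
                      let (suffix , rest′) = run (findCut G v rest cs) dir in
                      Cut L v suffix × Reaching L v rest′
    findCut-invariant pre []       R split inward =
      cut pre split inward (λ ()) , R
    findCut-invariant {v} pre (c ∷ cs) R split inward with adj G c v in cv
    ... | false = findCut-invariant (pre ∷ʳ c) cs R split′ inward′
      where
        split′ = trans split (sym (∷ʳ-++ pre c cs))
        inward′ : ∀ {c′} → c′ ∈ pre ∷ʳ c → Edge G c′ v → dir c′ v ≡ true
        inward′ c′∈ c′v with ∈-++⁻ pre c′∈
        ... | inj₁ c′∈pre = inward c′∈pre c′v
        ... | inj₂ (here refl) with () ← trans (sym cv) c′v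
    ... | true with dir c v in c≺v
    ...   | true = findCut-invariant (pre ∷ʳ c) cs R′ split′ inward′
      where
        split′ = trans split (sym (∷ʳ-++ pre c cs))
        pre⇝c = proj₁ (sorted-split pre (subst (AllPairs _⇝_) split L↑))
        R′ : Reaching L v cs
        R′ = reaching (pre ∷ʳ c) split′ (All.++⁺ (All.map (_◅◅ (c≺v ◅ ε)) pre⇝c) ((c≺v ◅ ε) ∷ []))
        inward′ : ∀ {c′} → c′ ∈ pre ∷ʳ c → Edge G c′ v → dir c′ v ≡ true
        inward′ c′∈ c′v with ∈-++⁻ pre c′∈
        ... | inj₁ c′∈pre  = inward c′∈pre c′v
        ... | inj₂ (here refl) = c≺v
    ...   | false = cut pre split inward outward , R
      where
        c⇝cs = proj₂ (sorted-split pre (subst (AllPairs _⇝_) split L↑))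
        outward : ∀ {c′} → c′ ∈ c ∷ cs → Edge G c′ v → dir c′ v ≡ false
        outward (here refl) _ = c≺v
        outward (there c′∈cs) _ = path⇒no-back-arc (reversed-arc cv c≺v ◅ All.lookup c⇝cs c′∈cs)

    findCut-correct : ∀ {v rest} → Reaching L v rest →
                            let (suffix , rest′) = run (findCut G v rest rest) dir in
                            Cut L v suffix × Reaching L v rest′
    findCut-correct R@(reaching pre split reach) =
      findCut-invariant pre _ R split (λ c∈pre cv → path⇒arc cv (All.lookup reach c∈pre))

    findCuts-correct : ∀ {vs rest} → AllPairs _⇝_ vs → (∀ {w} → w ∈ vs → Reaching L w rest) →
                       ∀ {w} → w ∈ vs → Cut L w (run (findCuts G vs rest) dir w)
    findCuts-correct {[]}     _            _ ()
    findCuts-correct {v ∷ vs} {rest} (v⇝vs ∷ vs↑) R {w} w∈ =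
      subst (Cut L w) (sym (cong-app (run-findCuts-∷ G dir v vs rest) w))
            (pick (w ≟ᶠ v) (findCuts-correct vs↑ R′))
      where
        suffix = proj₁ (run (findCut G v rest rest) dir)
        rest′  = proj₂ (run (findCut G v rest rest) dir)
        cuts   = run (findCuts G vs rest′) dir
        cut-v  = findCut-correct (R (here refl))

        R′ : ∀ {w} → w ∈ vs → Reaching L w rest′
        R′ w∈vs = let reaching pre split reach = proj₂ cut-v in
                  reaching pre split (All.map (_◅◅ All.lookup v⇝vs w∈vs) reach)

        pick : Dec (w ≡ v) → (∀ {w} → w ∈ vs → Cut L w (cuts w)) →
               Cut L w (Vector.updateAt cuts v (λ _ → suffix) w)
        pick (yes refl) _  = subst (Cut L v) (sym (updateAt-updates v cuts)) (proj₁ cut-v)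
        pick (no w≢v)   IH = subst (Cut L w) (sym (updateAt-minimal w v cuts w≢v)) (IH (tail w∈))
          where
            tail : w ∈ v ∷ vs → w ∈ vs
            tail (here w≡v)  = ⊥-elim (w≢v w≡v)
            tail (there w∈vs) = w∈vs

n≤2^⌈log₂n⌉ : ∀ n → n ≤ 2 ^ ⌈log₂ n ⌉
n≤2^⌈log₂n⌉ n = bound n (<-wellFounded n)
  where
    bound : ∀ m (acc : Acc _<_ m) → m ≤ 2 ^ ⌈log2⌉ m acc
    bound zero                _         = z≤n
    bound (suc zero)          _         = s≤s z≤n
    bound (suc (suc m)) (acc rs) = begin
      suc (suc m)                     ≡⟨ cong (λ l → suc (suc l)) (⌊n/2⌋+⌈n/2⌉≡n m) ⟨
      suc (suc (⌊ m /2⌋ + ⌈ m /2⌉))   ≤⟨ s≤s (s≤s (+-monoˡ-≤ ⌈ m /2⌉ (⌊n/2⌋≤⌈n/2⌉ m))) ⟩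
      suc (suc (⌈ m /2⌉ + ⌈ m /2⌉))   ≡⟨ cong suc (+-suc ⌈ m /2⌉ ⌈ m /2⌉) ⟨
      suc ⌈ m /2⌉ + suc ⌈ m /2⌉       ≤⟨ +-mono-≤ half half ⟩
      2^half + 2^half                 ≡⟨ cong (2^half +_) (+-identityʳ 2^half) ⟨
      2 ^ ⌈log2⌉ (suc (suc m)) (acc rs) ∎
      where
        open ≤-Reasoning
        half   = bound (suc ⌈ m /2⌉) _
        2^half = 2 ^ ⌈log2⌉ (suc ⌈ m /2⌉) _

module Algorithm {n k : ℕ} (G : Graph n) (f : Fin n → Fin k) where

  open import Data.List.Membership.DecPropositional (_≟ᶠ_ {n}) using (_∈?_)

  colourClass : Fin k → List (Fin n)
  colourClass i = filter (λ x → f x ≟ᶠ i) (allFin n)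

  sortClasses : Alg n (Fin k → List (Fin n))
  sortClasses = forEach λ i → mergeSort ⌈log₂ n ⌉ (colourClass i)

  cutClasses : (Fin k → List (Fin n)) → Alg n (Fin k → Fin k → Fin n → List (Fin n))
  cutClasses S = forEach λ i → forEach λ j → findCuts G (S i) (S j)

  -- T (f v) (f u) v is the part of the sorted class of u beyond the cut of v, so u → v iff u is not in it.
  orientationFrom : (Fin k → Fin k → Fin n → List (Fin n)) → Oracle n
  orientationFrom T u v = not (does (u ∈? T (f v) (f u) v))

  determine : Alg n (Oracle n)
  determine = sortClasses >>= λ S → cutClasses S >>= λ T → done (orientationFrom T)

  ∈-colourClass : ∀ x → x ∈ colourClass (f x)
  ∈-colourClass x = ∈-filter⁺ (λ y → f y ≟ᶠ f x) (∈-allFin x) refl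

  length-colourClass : ∀ i → length (colourClass i) ≤ n
  length-colourClass i = ≤-trans (length-filter (λ x → f x ≟ᶠ i) (allFin n)) (≤-reflexive (length-tabulate id))

  ∑-length-colourClass : ∑[ i < k ] length (colourClass i) ≡ n
  ∑-length-colourClass = trans (∑-length-filter-byColour f (allFin n)) (length-tabulate id)

  module _ (d : Oracle n) where

    private
      D = ⌈log₂ n ⌉
      S = run sortClasses d

    run-sortClasses : ∀ i → S i ≡ run (mergeSort D (colourClass i)) d
    run-sortClasses = run-forEach d _

    sortClasses-↭ : ∀ i → S i ↭ colourClass i
    sortClasses-↭ i = subst (_↭ colourClass i) (sym (run-sortClasses i)) (mergeSort-↭ d D (colourClass i))

    run-cutClasses : ∀ i j → run (cutClasses S) d i j ≡ run (findCuts G (S i) (S j)) d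
    run-cutClasses i j = trans (cong-app (run-forEach d _ i) j) (run-forEach d _ j)

    run-determine : run determine d ≡ orientationFrom (run (cutClasses S) d)
    run-determine = trans (run->>= d sortClasses _) (run->>= d (cutClasses S) _)

    probes-sortClasses : probes sortClasses d ≤ D * n
    probes-sortClasses = begin
      probes sortClasses d                      ≡⟨ probes-forEach d _ ⟩
      ∑[ i < k ] probes (mergeSort D (colourClass i)) d ≤⟨ ∑-mono-≤ (λ i → probes-mergeSort d D (colourClass i)) ⟩
      ∑[ i < k ] (D * length (colourClass i))    ≡⟨ *-distribˡ-sum D (λ i → length (colourClass i)) ⟨
      D * ∑[ i < k ] length (colourClass i)    ≡⟨ cong (D *_) ∑-length-colourClass ⟩
      D * n                                     ∎
      where open ≤-Reasoning

    probes-cutClasses : probes (cutClasses S) d ≤ k * n + k * n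
    probes-cutClasses = begin
      probes (cutClasses S) d
        ≡⟨ probes-forEach d _ ⟩
      ∑[ i < k ] probes (forEach λ j → findCuts G (S i) (S j)) d
        ≡⟨ sum-cong-≗ (λ i → probes-forEach d (λ j → findCuts G (S i) (S j))) ⟩
      ∑[ i < k ] ∑[ j < k ] probes (findCuts G (S i) (S j)) d
        ≤⟨ ∑-mono-≤ (λ i → ∑-mono-≤ (λ j → probes-findCuts G d (S i) (S j))) ⟩
      ∑[ i < k ] ∑[ j < k ] (length (S i) + length (S j))
        ≡⟨ sum-cong-≗ (λ i → sum-cong-≗ (λ j → cong₂ _+_ (|S| i) (|S| j))) ⟩
      ∑[ i < k ] ∑[ j < k ] (a i + a j)
        ≡⟨ ∑∑-pairs a ⟩
      k * ∑[ i < k ] a i + k * ∑[ i < k ] a i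
        ≡⟨ cong (λ m → k * m + k * m) ∑-length-colourClass ⟩
      k * n + k * n ∎
      where
        open ≤-Reasoning
        a = λ i → length (colourClass i)
        |S| = ↭-length ∘ sortClasses-↭

    probes-determine : probes determine d ≤ 2 * (n * D + n * k)
    probes-determine = begin
      probes determine d
        ≡⟨ trans (probes->>= d sortClasses _) (cong (probes sortClasses d +_) (probes->>= d (cutClasses S) _)) ⟩
      probes sortClasses d + (probes (cutClasses S) d + 0)
        ≤⟨ +-mono-≤ probes-sortClasses (≤-reflexive (+-identityʳ _)) ⟩
      D * n + probes (cutClasses S) d
        ≤⟨ +-monoʳ-≤ (D * n) probes-cutClasses ⟩
      D * n + (k * n + k * n)
        ≤⟨ m≤m+n _ (D * n) ⟩
      D * n + (k * n + k * n) + D * n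
        ≡⟨ regroup D n k ⟩
      2 * (n * D + n * k) ∎
      where
        open ≤-Reasoning
        regroup : ∀ D n k → D * n + (k * n + k * n) + D * n ≡ 2 * (n * D + n * k)
        regroup = solve-∀

  module _ {dir : Oracle n} (orientation : IsOrientation G dir) (acyclic : Acyclic dir)
           (proper : ProperColouringOfComplement G f) where

    open AcyclicOrientation orientation acyclic

    private
      S = run sortClasses dir
      T = run (cutClasses S) dir

    sameColour⇒reach : ∀ {x y} → f x ≡ f y → dir x y ≡ false → y ⇝ x
    sameColour⇒reach {x} {y} fx≡fy x⊀y with adj G x y in xy
    ... | true  = reversed-arc xy x⊀y ◅ ε
    ... | false with x ≟ᶠ y
    ...   | yes refl = ε
    ...   | no x≢y   = ⊥-elim (proper x y (x≢y , xy) fx≡fy)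

    sortClasses-sorted : ∀ i → AllPairs _⇝_ (S i)
    sortClasses-sorted i = subst (AllPairs _⇝_) (sym (run-sortClasses dir i))
      (mergeSort-sorted dir _◅◅_ (_◅ ε) (λ fx≡i fy≡i → sameColour⇒reach (trans fx≡i (sym fy≡i)))
        ⌈log₂ n ⌉ (colourClass i) (≤-trans (length-colourClass i) (n≤2^⌈log₂n⌉ n))
        (All.all-filter (λ x → f x ≟ᶠ i) (allFin n)))

    ∈-sortClasses : ∀ x → x ∈ S (f x)
    ∈-sortClasses x = ∈-resp-↭ (↭-sym (sortClasses-↭ dir (f x))) (∈-colourClass x)

    cutClasses-correct : ∀ u v → Cut (S (f u)) v (T (f v) (f u) v)
    cutClasses-correct u v = subst (Cut (S (f u)) v) (sym (cong-app (run-cutClasses dir (f v) (f u)) v))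
      (findCuts-correct (sortClasses-sorted (f u)) (sortClasses-sorted (f v))
                        (λ _ → reaching [] refl []) (∈-sortClasses v))

    orientationFrom-correct : Determines G (orientationFrom T) dir
    orientationFrom-correct u v uv with u ∈? T (f v) (f u) v
    ... | yes u∈suffix = sym (Cut.outward (cutClasses-correct u v) u∈suffix uv)
    ... | no  u∉suffix
      with ∈-++⁻ (Cut.prefix (cutClasses-correct u v))
                 (subst (u ∈_) (Cut.split (cutClasses-correct u v)) (∈-sortClasses u))
    ...   | inj₁ u∈prefix = sym (Cut.inward (cutClasses-correct u v) u∈prefix uv)
    ...   | inj₂ u∈suffix = ⊥-elim (u∉suffix u∈suffix)

mainTheorem1 : Σ ℕ λ C →
    ∀ (n : ℕ) → 2 ≤ n → (G : Graph n) → (k : ℕ) → (f : Fin n → Fin k) →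
    ProperColouringOfComplement G f →
    Σ (Alg n (Fin n → Fin n → Bool)) λ T →
    ∀ (dir : Fin n → Fin n → Bool) → IsAcyclicOrientation G dir →
    ProbesOnlyEdges G T dir
    × Determines G (run T dir) dir
    × probes T dir ≤ C * (n * ⌈log₂ n ⌉ + n * k)
mainTheorem1 = 2 , λ n _ G k f proper → edgesOnly G (determine G f) , λ dir (orientation , acyclic) →
  let silent = IsOrientation.offEdges orientation in
    edgesOnly-probesOnlyEdges G (determine G f) dir
  , subst (λ out → Determines G out dir)
          (sym (trans (run-edgesOnly G dir silent (determine G f)) (run-determine G f dir)))
          (orientationFrom-correct G f orientation acyclic proper)
  , ≤-trans (probes-edgesOnly G dir silent (determine G f)) (probes-determine G f dir)
  where open Algorithm
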